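{- Fix $n\ge1$. Let $H=(h_{a,b})_{0\le a\le b\le n}$ be an $h$-array with derived $t$-arrays $T_1(H)$ and $T_2(H)$. Then $H$ is a hive for $GL_n$ if and only if both $T_1(H)$ and $T_2(H)$ are GT patterns for $GL_n$.
   Context: A $t$-array is an array of integers $T=(t^{(i)}_j)_{1\le j\le i\le n}$. It is a GT pattern for $GL_n$ if it satisfies IC(1): $t^{(i+1)}_j\ge t^{(i)}_j$ and IC(2): $t^{(i)}_j\ge t^{(i+1)}_{j+1}$ for all $1\le j\le i\le n-1$. An $h$-array is an array of nonnegative integers $H=(h_{a,b})_{0\le a\le b\le n}$ with $h_{0,0}=0$. It is a hive for $GL_n$ if it satisfies the rhombus conditions RC(1): $h_{a,b}+h_{a-1,b-1}\ge h_{a-1,b}+h_{a,b-1}$ for $1\le a<b\le n$; RC(2): $h_{a-1,b}+h_{a,b}\ge h_{a,b+1}+h_{a-1,b-1}$ for $1\le a\le b<n$; RC(3): $h_{a,b}+h_{a,b+1}\ge h_{a+1,b+1}+h_{a-1,b}$ for $1\le a\le b<n$. The derived $t$-arrays $T_1(H)=(x^{(i)}_j)$ and $T_2(H)=(y^{(i)}_j)$ are defined, for $0\le a\le b\le n-1$, by $x^{(n-a)}_{b+1-a}=h_{a,b+1}-h_{a,b}$ and $y^{(b+1)}_{a+1}=h_{a+1,b+1}-h_{a,b+1}$. -}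

module Defs where

open import Data.Nat using (ℕ; suc; _+_; _∸_; _≤_; _<_)
open import Data.Integer as ℤ using (ℤ; +_)
open import Data.Product using (_×_)

-- A t-array (t^{(i)}_j), 1 ≤ j ≤ i ≤ n, of integers, represented as a
-- function i ↦ j ↦ t^{(i)}_j; only the entries with 1 ≤ j ≤ i ≤ n matter.
TArray : Set
TArray = ℕ → ℕ → ℤ

-- An h-array (h_{a,b}), 0 ≤ a ≤ b ≤ n, of nonnegative integers, as a
-- function a ↦ b ↦ h_{a,b}; only entries with 0 ≤ a ≤ b ≤ n matter.
-- (The condition h_{0,0} = 0 is imposed as a hypothesis in the theorem.)
HArray : Set
HArray = ℕ → ℕ → ℕ

IsGT : ℕ → TArray → Set
IsGT n t =
  (∀ i j → 1 ≤ j → j ≤ i → i ≤ n ∸ 1 → t i j ℤ.≤ t (suc i) j)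
  × (∀ i j → 1 ≤ j → j ≤ i → i ≤ n ∸ 1 → t (suc i) (suc j) ℤ.≤ t i j)

IsHive : ℕ → HArray → Set
IsHive n h =
  (∀ a b → 1 ≤ a → a < b → b ≤ n →
     h (a ∸ 1) b + h a (b ∸ 1) ≤ h a b + h (a ∸ 1) (b ∸ 1))
  × (∀ a b → 1 ≤ a → a ≤ b → b < n →
     h a (suc b) + h (a ∸ 1) (b ∸ 1) ≤ h (a ∸ 1) b + h a b)
  × (∀ a b → 1 ≤ a → a ≤ b → b < n →
     h (suc a) (suc b) + h (a ∸ 1) b ≤ h a b + h a (suc b))

-- Derived t-array T_1(H) = (x^{(i)}_j), defined by
--   x^{(n-a)}_{b+1-a} = h_{a,b+1} - h_{a,b}   for 0 ≤ a ≤ b ≤ n-1.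
-- Solving i = n-a, j = b+1-a gives a = n-i, b = n-i+j-1, a bijection
-- onto 1 ≤ j ≤ i ≤ n; so x^{(i)}_j = h_{n-i, n-i+j} - h_{n-i, n-i+j-1}.
T₁ : ℕ → HArray → TArray
T₁ n h i j = + h (n ∸ i) (n ∸ i + j) ℤ.- + h (n ∸ i) (n ∸ i + j ∸ 1)

-- Derived t-array T_2(H) = (y^{(i)}_j), defined by
--   y^{(b+1)}_{a+1} = h_{a+1,b+1} - h_{a,b+1}   for 0 ≤ a ≤ b ≤ n-1,
-- i.e. (i = b+1, j = a+1) y^{(i)}_j = h_{j,i} - h_{j-1,i}.
T₂ : ℕ → HArray → TArray
T₂ n h i j = + h j i ℤ.- + h (j ∸ 1) i

-- Every entry of T₁(H) is a horizontal difference Δ→ of H (along a row a)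
-- and every entry of T₂(H) a vertical difference Δ↓ (along a column).  For
-- naturals, comparing two integer differences x - y ≤ z - w is the same as
-- comparing the cross sums x + w ≤ z + y, so each rhombus inequality of H
-- is literally an interlacing inequality between differences.  Matching the
-- indices one gets
--   RC(1) ⇔ IC(1) for T₂,   RC(3) ⇔ IC(2) for T₂,   RC(2) ⇔ IC(1) for T₁,
-- and RC(1) ⇒ IC(2) for T₁ (this last one is redundant for the converse).
-- The only bookkeeping is the reindexing of T₁: its rows i and i+1 are the
-- rows a+1 and a of H, where (a+1) + i = n.
module Submission where

open import Defs
open import Data.Nat using (ℕ; zero; suc; _+_; _∸_; _≤_; _<_; z≤n; s≤s; s≤s⁻¹)
open import Data.Nat.Properties
  using (+-suc; +-comm; m≤m+n; m≤n+m; +-monoʳ-≤; +-cancelˡ-≤; m+n∸n≡m; m∸n+n≡m; <-trans; m≤n⇒∃[o]m+o≡n)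
open import Data.Integer as ℤ using (ℤ; +_; _-_; -_; +≤+)
open import Data.Integer.Properties using (pos-+; drop‿+≤+) renaming (+-monoˡ-≤ to ℤ-+-monoˡ-≤)
open import Data.Integer.Tactic.RingSolver using (solve-∀)
open import Data.Product using (_×_; _,_; ∃-syntax)
open import Function.Bundles using (_⇔_; mk⇔; Equivalence)
open import Relation.Binary.PropositionalEquality
  using (_≡_; refl; sym; trans; cong; subst; subst₂)

open Equivalence using (to; from)

diff≤diff⇔ᶻ : ∀ (x y z w : ℤ) → (x - y ℤ.≤ z - w) ⇔ (x ℤ.+ w ℤ.≤ z ℤ.+ y)
diff≤diff⇔ᶻ x y z w = mk⇔
  (λ le → subst₂ ℤ._≤_ (add₁ x y w) (add₂ z w y) (ℤ-+-monoˡ-≤ (y ℤ.+ w) le))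
  (λ le → subst₂ ℤ._≤_ (sub₁ x w y) (sub₂ z y w) (ℤ-+-monoˡ-≤ (- y - w) le))
  where
  add₁ : ∀ a b c → (a - b) ℤ.+ (b ℤ.+ c) ≡ a ℤ.+ c
  add₁ = solve-∀
  add₂ : ∀ a b c → (a - b) ℤ.+ (c ℤ.+ b) ≡ a ℤ.+ c
  add₂ = solve-∀
  sub₁ : ∀ a b c → (a ℤ.+ b) ℤ.+ (- c - b) ≡ a - c
  sub₁ = solve-∀
  sub₂ : ∀ a b c → (a ℤ.+ b) ℤ.+ (- b - c) ≡ a - c
  sub₂ = solve-∀

diff≤diff⇔ : ∀ (x y z w : ℕ) → (+ x - + y ℤ.≤ + z - + w) ⇔ (x + w ≤ z + y)
diff≤diff⇔ x y z w = mk⇔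
  (λ le → drop‿+≤+ (subst₂ ℤ._≤_ (sym (pos-+ x w)) (sym (pos-+ z y))
            (to (diff≤diff⇔ᶻ (+ x) (+ y) (+ z) (+ w)) le)))
  (λ le → from (diff≤diff⇔ᶻ (+ x) (+ y) (+ z) (+ w))
            (subst₂ ℤ._≤_ (pos-+ x w) (pos-+ z y) (+≤+ le)))

-- The three rhombus conditions and the two interlacing conditions, named
-- separately (IsHive and IsGT are by definition their products).
RC₁ RC₂ RC₃ : ℕ → HArray → Set
RC₁ n h = ∀ a b → 1 ≤ a → a < b → b ≤ n →
  h (a ∸ 1) b + h a (b ∸ 1) ≤ h a b + h (a ∸ 1) (b ∸ 1)
RC₂ n h = ∀ a b → 1 ≤ a → a ≤ b → b < n →
  h a (suc b) + h (a ∸ 1) (b ∸ 1) ≤ h (a ∸ 1) b + h a b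
RC₃ n h = ∀ a b → 1 ≤ a → a ≤ b → b < n →
  h (suc a) (suc b) + h (a ∸ 1) b ≤ h a b + h a (suc b)

IC₁ IC₂ : ℕ → TArray → Set
IC₁ n t = ∀ i j → 1 ≤ j → j ≤ i → i ≤ n ∸ 1 → t i j ℤ.≤ t (suc i) j
IC₂ n t = ∀ i j → 1 ≤ j → j ≤ i → i ≤ n ∸ 1 → t (suc i) (suc j) ℤ.≤ t i j

Δ→ Δ↓ : HArray → ℕ → ℕ → ℤ
Δ→ h a b = + h a (suc b) - + h a b
Δ↓ h a b = + h (suc a) b - + h a b

≤∸1⇒< : ∀ {j i n} → suc j ≤ i → i ≤ n ∸ 1 → i < n
≤∸1⇒< {n = suc n} _ i≤n = s≤s i≤n
≤∸1⇒< {n = zero} (s≤s _) ()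

<⇒≤∸1 : ∀ {i n} → i < n → i ≤ n ∸ 1
<⇒≤∸1 (s≤s i≤n) = i≤n

rc₁-horizontal : ∀ h p q → (Δ→ h p q ℤ.≤ Δ→ h (suc p) q) ⇔
  (h p (suc q) + h (suc p) q ≤ h (suc p) (suc q) + h p q)
rc₁-horizontal h p q = diff≤diff⇔ (h p (suc q)) (h p q) (h (suc p) (suc q)) (h (suc p) q)

rc₁-vertical : ∀ h p q → (Δ↓ h p q ℤ.≤ Δ↓ h p (suc q)) ⇔
  (h p (suc q) + h (suc p) q ≤ h (suc p) (suc q) + h p q)
rc₁-vertical h p q = mk⇔
  (λ le → subst (_≤ h (suc p) (suc q) + h p q) (+-comm (h (suc p) q) (h p (suc q))) (to reading le))
  (λ le → from reading (subst (_≤ h (suc p) (suc q) + h p q) (+-comm (h p (suc q)) (h (suc p) q)) le))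
  where
  reading : (Δ↓ h p q ℤ.≤ Δ↓ h p (suc q)) ⇔
    (h (suc p) q + h p (suc q) ≤ h (suc p) (suc q) + h p q)
  reading = diff≤diff⇔ (h (suc p) q) (h p q) (h (suc p) (suc q)) (h p (suc q))

rc₂-horizontal : ∀ h p q → (Δ→ h (suc p) (suc q) ℤ.≤ Δ→ h p q) ⇔
  (h (suc p) (suc (suc q)) + h p q ≤ h p (suc q) + h (suc p) (suc q))
rc₂-horizontal h p q =
  diff≤diff⇔ (h (suc p) (suc (suc q))) (h (suc p) (suc q)) (h p (suc q)) (h p q)

rc₃-vertical : ∀ h p q → (Δ↓ h (suc p) (suc q) ℤ.≤ Δ↓ h p q) ⇔
  (h (suc (suc p)) (suc q) + h p q ≤ h (suc p) q + h (suc p) (suc q))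
rc₃-vertical h p q =
  diff≤diff⇔ (h (suc (suc p)) (suc q)) (h (suc p) (suc q)) (h (suc p) q) (h p q)

RC₁⇔T₂-IC₁ : ∀ n h → RC₁ n h ⇔ IC₁ n (T₂ n h)
RC₁⇔T₂-IC₁ n h = mk⇔ hive⇒gt gt⇒hive
  where
  hive⇒gt : RC₁ n h → IC₁ n (T₂ n h)
  hive⇒gt rc i (suc p) _ j≤i i≤n =
    from (rc₁-vertical h p i) (rc (suc p) (suc i) (s≤s z≤n) (s≤s j≤i) (≤∸1⇒< j≤i i≤n))
  gt⇒hive : IC₁ n (T₂ n h) → RC₁ n h
  gt⇒hive ic (suc p) (suc q) _ (s≤s a≤q) b≤n =
    to (rc₁-vertical h p q) (ic q (suc p) (s≤s z≤n) a≤q (<⇒≤∸1 b≤n))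

RC₃⇔T₂-IC₂ : ∀ n h → RC₃ n h ⇔ IC₂ n (T₂ n h)
RC₃⇔T₂-IC₂ n h = mk⇔ hive⇒gt gt⇒hive
  where
  hive⇒gt : RC₃ n h → IC₂ n (T₂ n h)
  hive⇒gt rc i (suc p) _ j≤i i≤n =
    from (rc₃-vertical h p i) (rc (suc p) i (s≤s z≤n) j≤i (≤∸1⇒< j≤i i≤n))
  gt⇒hive : IC₂ n (T₂ n h) → RC₃ n h
  gt⇒hive ic (suc p) b _ a≤b b<n =
    to (rc₃-vertical h p b) (ic b (suc p) (s≤s z≤n) a≤b (<⇒≤∸1 b<n))

T₁-Δ→ : ∀ n h i k → T₁ n h i (suc k) ≡ Δ→ h (n ∸ i) (n ∸ i + k)
T₁-Δ→ n h i k = cong (λ m → + h (n ∸ i) m - + h (n ∸ i) (m ∸ 1)) (+-suc (n ∸ i) k)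

T₁-row-below : ∀ h a i k → T₁ (suc a + i) h (suc i) (suc k) ≡ Δ→ h a (a + k)
T₁-row-below h a i k =
  trans (T₁-Δ→ (suc a + i) h (suc i) k) (cong (λ c → Δ→ h c (c + k)) (m+n∸n≡m a i))

T₁-row-above : ∀ h a i k → T₁ (suc a + i) h i (suc k) ≡ Δ→ h (suc a) (suc (a + k))
T₁-row-above h a i k =
  trans (T₁-Δ→ (suc a + i) h i k) (cong (λ c → Δ→ h c (c + k)) (m+n∸n≡m (suc a) i))

complementary-row : ∀ {i n} → i < n → ∃[ a ] suc a + i ≡ n
complementary-row {i} {n} i<n = n ∸ suc i , trans (sym (+-suc (n ∸ suc i) i)) (m∸n+n≡m i<n)

index-bound : ∀ a i k → suc k ≤ i ⇔ suc (suc (a + k)) ≤ suc a + i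
index-bound a i k = mk⇔
  (λ le → s≤s (subst (_≤ a + i) (+-suc a k) (+-monoʳ-≤ a le)))
  (λ le → +-cancelˡ-≤ a _ _ (subst (_≤ a + i) (sym (+-suc a k)) (s≤s⁻¹ le)))

RC₂⇒T₁-IC₁ : ∀ n h → RC₂ n h → IC₁ n (T₁ n h)
RC₂⇒T₁-IC₁ n h rc i (suc k) _ j≤i i≤n with complementary-row (≤∸1⇒< {n = n} j≤i i≤n)
... | a , refl =
  subst₂ ℤ._≤_ (sym (T₁-row-above h a i k)) (sym (T₁-row-below h a i k))
    (from (rc₂-horizontal h a (a + k))
      (rc (suc a) (suc (a + k)) (s≤s z≤n) (s≤s (m≤m+n a k)) (to (index-bound a i k) j≤i)))

T₁-IC₁⇒RC₂ : ∀ n h → IC₁ n (T₁ n h) → RC₂ n h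
T₁-IC₁⇒RC₂ n h ic (suc p) b _ a≤b b<n
  with m≤n⇒∃[o]m+o≡n a≤b | m≤n⇒∃[o]m+o≡n (<-trans a≤b b<n)
... | k , refl | i , refl =
  to (rc₂-horizontal h p (p + k))
    (subst₂ ℤ._≤_ (T₁-row-above h p i k) (T₁-row-below h p i k)
      (ic i (suc k) (s≤s z≤n) (from (index-bound p i k) b<n) (m≤n+m i p)))

RC₁⇒T₁-IC₂ : ∀ n h → RC₁ n h → IC₂ n (T₁ n h)
RC₁⇒T₁-IC₂ n h rc i (suc k) _ j≤i i≤n with complementary-row (≤∸1⇒< {n = n} j≤i i≤n)
... | a , refl =
  subst₂ ℤ._≤_ (sym (trans (T₁-row-below h a i (suc k)) (cong (Δ→ h a) (+-suc a k))))
    (sym (T₁-row-above h a i k))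
    (from (rc₁-horizontal h a (suc (a + k)))
      (rc (suc a) (suc (suc (a + k))) (s≤s z≤n) (s≤s (s≤s (m≤m+n a k)))
        (to (index-bound a i k) j≤i)))

theorem2p5 : (n : ℕ) → 1 ≤ n → (h : HArray) → h 0 0 ≡ 0 →
    (IsHive n h ⇔ (IsGT n (T₁ n h) × IsGT n (T₂ n h)))
theorem2p5 n _ h _ = mk⇔
  (λ (rc₁ , rc₂ , rc₃) →
     (RC₂⇒T₁-IC₁ n h rc₂ , RC₁⇒T₁-IC₂ n h rc₁) ,
     (to (RC₁⇔T₂-IC₁ n h) rc₁ , to (RC₃⇔T₂-IC₂ n h) rc₃))
  (λ ((ic₁ , _) , (ic₁′ , ic₂′)) →
     from (RC₁⇔T₂-IC₁ n h) ic₁′ , T₁-IC₁⇒RC₂ n h ic₁ , from (RC₃⇔T₂-IC₂ n h) ic₂′)
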